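{- Let $H$ be a finite digraph possibly with loops, $D$ a finite $H$-colored digraph without loops and without isolated vertices, and $\xi=\{C_1,\dots,C_k\}$ ($k\ge2$) a partition of $V(H)$ such that for every $i$ the set $A_i=\{a\in A(D):c(a)\in C_i\}$ is nonempty and $G_i=D[A_i]$ is transitive by $H$-paths. Suppose that (1) for every cycle $\gamma$ in $D$ there exists $i\in\{1,\dots,k\}$ such that $\gamma$ is contained in $G_i$, and (2) for every $H$-walk $P$ in $D$ there exists $j\in\{1,\dots,k\}$ such that $P$ is contained in $G_j$. Then there exists $x_0\in V(D)$ such that $\{x_0\}$ is an $H$-semikernel of $D$.
   Context: Paths, walks and cycles are directed; a path has pairwise distinct vertices. $D$ is $H$-colored if it has an arc coloring $c:A(D)\to V(H)$. A walk $(v_0,\dots,v_n)$ is an $H$-walk if $(c(v_0,v_1),\dots,c(v_{n-1},v_n))$ is a walk in $H$ (a single arc is an $H$-walk); an $H$-path is a path that is an $H$-walk. $D[A]$ for an arc set $A$ is the subdigraph with arc set $A$ and vertex set the ends of arcs in $A$. A subdigraph $G$ is transitive by $H$-paths if an $xy$-$H$-path contained in $G$ and a $yz$-$H$-path contained in $G$ imply an $xz$-$H$-path contained in $G$. A set $S\subseteq V(D)$ is an $H$-semikernel of $D$ if (i) $S$ is $H$-independent (no $H$-path in $D$ between two distinct vertices of $S$), and (ii) for every $z\in V(D)\setminus S$, if there is an $H$-path in $D$ from a vertex of $S$ to $z$, then there is an $H$-path in $D$ from $z$ to a vertex of $S$. -}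

module Defs where

open import Data.Nat using (ℕ; zero; suc; _≤_; _<_)
open import Data.Fin using (Fin; zero; suc; toℕ; inject₁; fromℕ)
open import Data.Fin.Subset using (Subset; _∈_; _∉_)
open import Data.Sum using (_⊎_)
open import Data.Bool using (Bool; true; false; T)
open import Data.Product using (Σ; ∃; ∃-syntax; _×_; _,_)
open import Relation.Binary.PropositionalEquality using (_≡_; _≢_)
open import Relation.Nullary using (¬_)

-- Conventions.
--  * A finite digraph D has vertex set Fin n and arc relation E : Fin n → Fin n → Bool
--    (E u v ≡ true iff (u,v) is an arc).
--  * A finite digraph H (loops allowed) has vertex set Fin m and arc relation Hrel.
--  * An H-coloring of D is c : Fin n → Fin n → Fin m; only its values on arcs matter.

module _ {n m : ℕ} (E : Fin n → Fin n → Bool) (Hrel : Fin m → Fin m → Bool)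
         (c : Fin n → Fin n → Fin m) where

  record Walk : Set where
    field
      len  : ℕ
      vert : Fin (suc len) → Fin n
      arcs : (i : Fin len) → T (E (vert (inject₁ i)) (vert (suc i)))

  open Walk public

  start : Walk → Fin n
  start w = vert w zero

  end : Walk → Fin n
  end w = vert w (fromℕ (len w))

  colorAt : (w : Walk) → Fin (len w) → Fin m
  colorAt w i = c (vert w (inject₁ i)) (vert w (suc i))

  IsHWalk : Walk → Set
  IsHWalk w = (1 ≤ len w) ×
    ((i j : Fin (len w)) → toℕ j ≡ suc (toℕ i) → T (Hrel (colorAt w i) (colorAt w j)))

  IsPath : Walk → Set
  IsPath w = (i j : Fin (suc (len w))) → vert w i ≡ vert w j → i ≡ j

  IsCycle : Walk → Set
  IsCycle w = (1 ≤ len w) × (start w ≡ end w) ×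
    ((i j : Fin (suc (len w))) → toℕ i < len w → toℕ j < len w → vert w i ≡ vert w j → i ≡ j)

  HPath : Fin n → Fin n → Set
  HPath x y = Σ Walk λ w → IsHWalk w × IsPath w × start w ≡ x × end w ≡ y

  HIndependent : Subset n → Set
  HIndependent S = (x y : Fin n) → x ∈ S → y ∈ S → x ≢ y → ¬ HPath x y

  IsHSemikernel : Subset n → Set
  IsHSemikernel S = HIndependent S ×
    ((z : Fin n) → z ∉ S → (∃[ x ] (x ∈ S × HPath x z)) → ∃[ y ] (y ∈ S × HPath z y))

  module _ {k : ℕ} (part : Fin m → Fin k) where
    -- The partition ξ = {C_1,...,C_k} of V(H) is given by part : V(H) → Fin k,
    -- C_i = part⁻¹(i).  A_i = arcs whose colour lies in C_i; G_i = D[A_i].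

    WalkIn : Walk → Fin k → Set
    WalkIn w i = (a : Fin (len w)) → part (colorAt w a) ≡ i

    HPathIn : Fin k → Fin n → Fin n → Set
    HPathIn i x y = Σ Walk λ w → IsHWalk w × IsPath w × start w ≡ x × end w ≡ y × WalkIn w i

    -- G_i is transitive by H-paths (x ≠ z, since an x x-path is trivial)
    TransitiveByHPaths : Fin k → Set
    TransitiveByHPaths i = (x y z : Fin n) → x ≢ z →
      HPathIn i x y → HPathIn i y z → HPathIn i x z

    ArcClassNonempty : Fin k → Set
    ArcClassNonempty i = ∃[ u ] ∃[ v ] (T (E u v) × part (c u v) ≡ i)

NoLoops : {n : ℕ} → (Fin n → Fin n → Bool) → Set
NoLoops {n} E = (v : Fin n) → E v v ≡ false

NoIsolated : {n : ℕ} → (Fin n → Fin n → Bool) → Set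
NoIsolated {n} E = (v : Fin n) → ∃[ u ] (T (E v u) ⊎ T (E u v))

-- Since D is finite, some vertex x₀ lies in a terminal strong component: every vertex
-- reachable from x₀ reaches x₀ back.  Let P be an H-path from x₀ to z; by (2) it lies in
-- one class G_j.  For each arc (u, v) of P, the terminal component contains a path from
-- v back to u; together with (u, v) it closes a cycle, which by (1) lies in a single
-- class, necessarily the class G_j of (u, v).  Chaining these return paths gives a
-- walk, hence a path, from z to x₀ inside G_j.  Its arcs are H-paths of G_j, so
-- transitivity of G_j by H-paths fuses them into an H-path from z to x₀.
module Submission where

open import Defs
open import Data.Nat using (ℕ; _≤_)
open import Data.Fin using (Fin)
open import Data.Fin.Subset using (⁅_⁆)
open import Data.Bool using (Bool)
open import Data.Product using (∃-syntax; _×_)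
open import Function using (Surjective)
open import Relation.Binary.PropositionalEquality using (_≡_)

open import Data.Bool using (T)
open import Data.Empty using (⊥-elim)
open import Data.Fin using (zero; suc; toℕ; inject₁; fromℕ; _≟_)
open import Data.Fin.Properties using (any?; injective⇒≤; toℕ-fromℕ)
open import Data.Fin.Subset using (Subset; _∈_; _∉_; _⊂_; ∣_∣)
open import Data.Fin.Subset.Properties using (x∈⁅x⁆; x∈⁅y⁆⇒x≡y; p⊂q⇒∣p∣<∣q∣)
open import Data.Nat using (zero; suc; z≤n; s≤s; _<_)
open import Data.Nat.Induction using (<-wellFounded)
open import Data.Nat.Properties using (<⇒≤; <-irrefl)
open import Data.Product using (Σ; ∃; _,_; proj₁; proj₂)
open import Data.Unit using (⊤; tt)
open import Data.Vec using (tabulate)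
open import Data.Vec.Properties using (lookup∘tabulate; []=⇒lookup; lookup⇒[]=)
open import Function using (Injective)
open import Induction.WellFounded using (Acc; acc)
open import Relation.Binary using (Decidable; Reflexive; Transitive)
open import Relation.Binary.Construct.Closure.ReflexiveTransitive using (Star; ε; _◅_; _◅◅_)
open import Relation.Binary.PropositionalEquality using (_≢_; refl; sym; trans; cong; subst; subst₂)
open import Relation.Nullary using (¬_; Dec; yes; no; does)
open import Relation.Nullary.Decidable using (map′; dec-true; decidable-stable; _×-dec_; ¬?; T?)

module _ {n : ℕ} {A : Fin n → Fin n → Set} where

  length : ∀ {x y} → Star A x y → ℕ
  length ε = 0
  length (_ ◅ w) = suc (length w)

  vertexAt : ∀ {x y} (w : Star A x y) → Fin (suc (length w)) → Fin n
  vertexAt {x} w zero = x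
  vertexAt (_ ◅ w) (suc t) = vertexAt w t

  vertexAt-last : ∀ {x y} (w : Star A x y) → vertexAt w (fromℕ (length w)) ≡ y
  vertexAt-last ε = refl
  vertexAt-last (_ ◅ w) = vertexAt-last w

  fromVertices : ∀ l (v : Fin (suc l) → Fin n) →
    ((t : Fin l) → A (v (inject₁ t)) (v (suc t))) → Star A (v zero) (v (fromℕ l))
  fromVertices zero v arcs = ε
  fromVertices (suc l) v arcs = arcs zero ◅ fromVertices l (λ t → v (suc t)) (λ t → arcs (suc t))

  Simple : ∀ {x y} → Star A x y → Set
  Simple ε = ⊤
  Simple (_◅_ {x} _ w) = (∀ t → vertexAt w t ≢ x) × Simple w

  SimpleWalk : Fin n → Fin n → Set
  SimpleWalk x y = Σ (Star A x y) Simple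

  simple⇒vertexAt-injective : ∀ {x y} (w : Star A x y) → Simple w → Injective _≡_ _≡_ (vertexAt w)
  simple⇒vertexAt-injective w _ {zero} {zero} _ = refl
  simple⇒vertexAt-injective (_ ◅ w) (x∉w , _) {zero} {suc t} eq = ⊥-elim (x∉w t (sym eq))
  simple⇒vertexAt-injective (_ ◅ w) (x∉w , _) {suc s} {zero} eq = ⊥-elim (x∉w s eq)
  simple⇒vertexAt-injective (_ ◅ w) (_ , simple) {suc s} {suc t} eq =
    cong suc (simple⇒vertexAt-injective w simple eq)

  simple⇒length< : ∀ {x y} (w : Star A x y) → Simple w → length w < n
  simple⇒length< w simple = injective⇒≤ (simple⇒vertexAt-injective w simple)

  suffixFrom : ∀ {x y z} (w : Star A y z) → Simple w →
    (t : Fin (suc (length w))) → vertexAt w t ≡ x → SimpleWalk x z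
  suffixFrom w simple zero refl = w , simple
  suffixFrom (_ ◅ w) (_ , simple) (suc t) eq = suffixFrom w simple t eq

  shorten : ∀ {x y} → Star A x y → SimpleWalk x y
  shorten ε = ε , tt
  shorten (_◅_ {x} a w) with shorten w
  ... | p , simple with any? (λ t → vertexAt p t ≟ x)
  ... | yes (t , eq) = suffixFrom p simple t eq
  ... | no x∉p = a ◅ p , (λ t eq → x∉p (t , eq)) , simple

  module _ (A? : Decidable A) where

    walkOfLength≤? : ∀ b x y → Dec (Σ (Star A x y) λ w → length w ≤ b)
    walkOfLength≤? zero x y with x ≟ y
    ... | yes refl = yes (ε , z≤n)
    ... | no x≢y = no λ { (ε , _) → x≢y refl ; (_ ◅ _ , ()) }
    walkOfLength≤? (suc b) x y with x ≟ y | any? (λ v → A? x v ×-dec walkOfLength≤? b v y)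
    ... | yes refl | _ = yes (ε , z≤n)
    ... | no _ | yes (_ , a , w , l) = yes (a ◅ w , s≤s l)
    ... | no x≢y | no ¬step =
      no λ { (ε , _) → x≢y refl ; (a ◅ w , s≤s l) → ¬step (_ , a , w , l) }

    star? : Decidable (Star A)
    star? x y = map′ proj₁ bounded (walkOfLength≤? n x y)
      where
      bounded : Star A x y → Σ (Star A x y) λ w → length w ≤ n
      bounded w with shorten w
      ... | p , simple = p , <⇒≤ (simple⇒length< p simple)

Terminal : ∀ {n} → (Fin n → Fin n → Set) → Fin n → Set
Terminal R x = ∀ y → R x y → R y x

module _ {n : ℕ} {R : Fin n → Fin n → Set}
         (R-refl : Reflexive R) (R-trans : Transitive R) (R? : Decidable R) where

  private
    upset : Fin n → Subset n
    upset x = tabulate (λ y → does (R? x y))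

    R⇒∈upset : ∀ {x y} → R x y → y ∈ upset x
    R⇒∈upset {x} {y} xRy =
      lookup⇒[]= y (upset x) (trans (lookup∘tabulate _ y) (dec-true (R? x y) xRy))

    ∈upset⇒R : ∀ {x y} → y ∈ upset x → R x y
    ∈upset⇒R {x} {y} y∈
      with R? x y | trans (sym (lookup∘tabulate (λ y → does (R? x y)) y)) ([]=⇒lookup y∈)
    ... | yes xRy | _ = xRy
    ... | no _ | ()

    upset-⊂ : ∀ {x y} → R x y → ¬ R y x → upset y ⊂ upset x
    upset-⊂ {x} xRy ¬yRx =
      (λ v∈ → R⇒∈upset (R-trans xRy (∈upset⇒R v∈))) ,
      x , R⇒∈upset R-refl , λ x∈ → ¬yRx (∈upset⇒R x∈)

    terminal-from : ∀ x → Acc _<_ ∣ upset x ∣ → ∃ (Terminal R)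
    terminal-from x (acc smaller) with any? (λ y → R? x y ×-dec ¬? (R? y x))
    ... | yes (y , xRy , ¬yRx) = terminal-from y (smaller (p⊂q⇒∣p∣<∣q∣ (upset-⊂ xRy ¬yRx)))
    ... | no ¬escape =
      x , λ y xRy → decidable-stable (R? y x) (λ ¬yRx → ¬escape (y , xRy , ¬yRx))

  ∃-terminal : Fin n → ∃ (Terminal R)
  ∃-terminal x = terminal-from x (<-wellFounded _)

module Digraph {n m k : ℕ} (E : Fin n → Fin n → Bool) (Hrel : Fin m → Fin m → Bool)
               (c : Fin n → Fin n → Fin m) (part : Fin m → Fin k) where

  Arc : Fin n → Fin n → Set
  Arc u v = T (E u v)

  ArcIn : Fin k → Fin n → Fin n → Set
  ArcIn i u v = Arc u v × part (c u v) ≡ i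

  CyclesInOneClass : Set
  CyclesInOneClass = (γ : Walk E Hrel c) → IsCycle E Hrel c γ → ∃[ i ] WalkIn E Hrel c part γ i

  HWalksInOneClass : Set
  HWalksInOneClass = (P : Walk E Hrel c) → IsHWalk E Hrel c P → ∃[ j ] WalkIn E Hrel c part P j

  toWalk : ∀ {x y} → Star Arc x y → Walk E Hrel c
  toWalk w = record { len = length w ; vert = vertexAt w ; arcs = arcAt w }
    where
    arcAt : ∀ {x y} (w : Star Arc x y) (t : Fin (length w)) →
      Arc (vertexAt w (inject₁ t)) (vertexAt w (suc t))
    arcAt (a ◅ _) zero = a
    arcAt (_ ◅ w) (suc t) = arcAt w t

  fromWalkIn : ∀ {i} (w : Walk E Hrel c) → WalkIn E Hrel c part w i →
    Star (ArcIn i) (start E Hrel c w) (end E Hrel c w)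
  fromWalkIn w w⊆Gᵢ = fromVertices (len w) (vert w) (λ t → arcs w t , w⊆Gᵢ t)

  restrict : ∀ {i x y} (w : Star Arc x y) → WalkIn E Hrel c part (toWalk w) i → Star (ArcIn i) x y
  restrict ε _ = ε
  restrict (a ◅ w) w⊆Gᵢ = (a , w⊆Gᵢ zero) ◅ restrict w (λ t → w⊆Gᵢ (suc t))

  HPathIn⇒HPath : ∀ {i x y} → HPathIn E Hrel c part i x y → HPath E Hrel c x y
  HPathIn⇒HPath (w , hwalk , path , s , e , _) = w , hwalk , path , s , e

  ⁅⁆-HIndependent : ∀ x → HIndependent E Hrel c ⁅ x ⁆
  ⁅⁆-HIndependent x y z y∈ z∈ y≢z _ =
    y≢z (trans (x∈⁅y⁆⇒x≡y x y∈) (sym (x∈⁅y⁆⇒x≡y x z∈)))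

  arc+simple⇒IsCycle : ∀ {u v} (a : Arc u v) (p : Star Arc v u) → Simple p →
    IsCycle E Hrel c (toWalk (a ◅ p))
  arc+simple⇒IsCycle a p simple = s≤s z≤n , sym (vertexAt-last p) , distinct
    where
    l = length p
    inj = simple⇒vertexAt-injective p simple
    notLast : ∀ t → toℕ t < l → vertexAt p t ≢ vertexAt p (fromℕ l)
    notLast t t<l eq = <-irrefl (trans (cong toℕ (inj eq)) (toℕ-fromℕ l)) t<l
    distinct : ∀ i j → toℕ i < suc l → toℕ j < suc l →
      vertexAt (a ◅ p) i ≡ vertexAt (a ◅ p) j → i ≡ j
    distinct zero zero _ _ _ = refl
    distinct zero (suc t) _ (s≤s t<l) eq =
      ⊥-elim (notLast t t<l (trans (sym eq) (sym (vertexAt-last p))))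
    distinct (suc t) zero (s≤s t<l) _ eq =
      ⊥-elim (notLast t t<l (trans eq (sym (vertexAt-last p))))
    distinct (suc s) (suc t) _ _ eq = cong suc (inj eq)

  -- The cycle (u, v) · p lies in one class, which its first arc identifies.
  returnPathInClass : CyclesInOneClass → ∀ {u v} (a : Arc u v) (p : Star Arc v u) → Simple p →
    Star (ArcIn (part (c u v))) v u
  returnPathInClass cycles a p simple
    with cycles (toWalk (a ◅ p)) (arc+simple⇒IsCycle a p simple)
  ... | _ , γ⊆Gᵢ = restrict p (λ t → trans (γ⊆Gᵢ (suc t)) (sym (γ⊆Gᵢ zero)))

  module _ (cycles : CyclesInOneClass) {x₀} (x₀-terminal : Terminal (Star Arc) x₀) where

    reverseArcInClass : ∀ {i u v} → Star Arc x₀ u → ArcIn i u v → Star (ArcIn i) v u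
    reverseArcInClass {v = v} x₀↝u (a , refl)
      with shorten (x₀-terminal v (x₀↝u ◅◅ a ◅ ε) ◅◅ x₀↝u)
    ... | p , simple = returnPathInClass cycles a p simple

    reverseInClass : ∀ {i u v} → Star Arc x₀ u → Star (ArcIn i) u v → Star (ArcIn i) v u
    reverseInClass _ ε = ε
    reverseInClass x₀↝u (a ◅ w) =
      reverseInClass (x₀↝u ◅◅ proj₁ a ◅ ε) w ◅◅ reverseArcInClass x₀↝u a

  module _ (noLoops : NoLoops E) {i} (transitive : TransitiveByHPaths E Hrel c part i) where

    arc⇒HPathIn : ∀ {u v} → ArcIn i u v → HPathIn E Hrel c part i u v
    arc⇒HPathIn {u} (a , a∈Aᵢ) =
      toWalk (a ◅ ε) , (s≤s z≤n , λ { zero zero () }) , path , refl , refl , λ { zero → a∈Aᵢ }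
      where
      noLoop : ∀ {v} → Arc u v → u ≢ v
      noLoop a refl = subst T (noLoops u) a
      path : IsPath E Hrel c (toWalk (a ◅ ε))
      path zero zero _ = refl
      path zero (suc zero) eq = ⊥-elim (noLoop a eq)
      path (suc zero) zero eq = ⊥-elim (noLoop a (sym eq))
      path (suc zero) (suc zero) _ = refl

    simple⇒HPathIn : ∀ {x z} (w : Star (ArcIn i) x z) → Simple w → x ≢ z →
      HPathIn E Hrel c part i x z
    simple⇒HPathIn ε _ x≢z = ⊥-elim (x≢z refl)
    simple⇒HPathIn (a ◅ ε) _ _ = arc⇒HPathIn a
    simple⇒HPathIn {x} {z} (a ◅ b ◅ w) (_ , simple@(y∉w , _)) x≢z =
      transitive x _ z x≢z (arc⇒HPathIn a) (simple⇒HPathIn (b ◅ w) simple y≢z)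
      where
      y≢z : _ ≢ z
      y≢z eq = y∉w (fromℕ (length w)) (trans (vertexAt-last w) (sym eq))

  terminal-absorbs : NoLoops E → (∀ i → TransitiveByHPaths E Hrel c part i) →
    CyclesInOneClass → HWalksInOneClass →
    ∀ {x₀ z} → Terminal (Star Arc) x₀ → z ≢ x₀ → HPath E Hrel c x₀ z → HPath E Hrel c z x₀
  terminal-absorbs noLoops transitive cycles hwalks x₀-terminal z≢x₀ (P , hwalk , _ , s , e)
    with hwalks P hwalk
  ... | j , P⊆Gⱼ
    with shorten (reverseInClass cycles x₀-terminal ε (subst₂ (Star (ArcIn j)) s e (fromWalkIn P P⊆Gⱼ)))
  ... | back , simple = HPathIn⇒HPath (simple⇒HPathIn noLoops (transitive j) back simple z≢x₀)

mainTheorem6 : (n m k : ℕ) (E : Fin n → Fin n → Bool) (Hrel : Fin m → Fin m → Bool)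
    (c : Fin n → Fin n → Fin m) (part : Fin m → Fin k) →
    NoLoops E → NoIsolated E → 2 ≤ k →
    Surjective _≡_ _≡_ part →
    ((i : Fin k) → ArcClassNonempty E Hrel c part i) →
    ((i : Fin k) → TransitiveByHPaths E Hrel c part i) →
    ((γ : Walk E Hrel c) → IsCycle E Hrel c γ → ∃[ i ] WalkIn E Hrel c part γ i) →
    ((P : Walk E Hrel c) → IsHWalk E Hrel c P → ∃[ j ] WalkIn E Hrel c part P j) →
    ∃[ x₀ ] IsHSemikernel E Hrel c ⁅ x₀ ⁆
-- Isolated vertices and surjectivity of part are irrelevant; k ≥ 2 and A₁ ≠ ∅ only supply a vertex.
mainTheorem6 n m (suc k) E Hrel c part noLoops _ _ _ nonempty transitive cycles hwalks =
  x₀ , ⁅⁆-HIndependent x₀ , absorbs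
  where
  open Digraph E Hrel c part
  terminal : ∃ (Terminal (Star Arc))
  terminal = ∃-terminal ε _◅◅_ (star? (λ u v → T? (E u v))) (proj₁ (nonempty zero))
  x₀ = proj₁ terminal
  absorbs : ∀ z → z ∉ ⁅ x₀ ⁆ → ∃[ x ] (x ∈ ⁅ x₀ ⁆ × HPath E Hrel c x z) →
    ∃[ y ] (y ∈ ⁅ x₀ ⁆ × HPath E Hrel c z y)
  absorbs z z∉ (x , x∈ , x↝z) with x∈⁅y⁆⇒x≡y x₀ x∈
  ... | refl =
    x₀ , x∈⁅x⁆ x₀ , terminal-absorbs noLoops transitive cycles hwalks (proj₂ terminal) z≢x₀ x↝z
    where
    z≢x₀ : z ≢ x₀
    z≢x₀ refl = z∉ (x∈⁅x⁆ x₀)
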